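{- Let $G=(V,E)$ be a connected graph with at least two vertices. Then $$\sum_{W\subseteq V}(-1)^{|W|}\,\mathrm{ID}(G[W],x)=1.$$
   Context: All graphs are finite, simple and undirected. $G[W]$ denotes the subgraph induced by $W$; $G[\emptyset]$ is the graph with no vertices. A set $W\subseteq V$ is an independent dominating set of $G=(V,E)$ if every vertex of $V\setminus W$ is adjacent to at least one vertex of $W$ and no two vertices of $W$ are adjacent. The independent domination polynomial is $\mathrm{ID}(G,x)=\sum_{W}x^{|W|}$, the sum over all independent dominating sets $W$ of $G$. For the graph with no vertices it equals $1$. -}

module Defs where

open import Data.Nat using (ℕ; zero; suc)
open import Data.Bool using (Bool; true; false; T)
open import Data.Fin using (Fin)
open import Data.Fin.Subset using (Subset; _∈_; _∉_; _⊆_; ∣_∣)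
open import Data.Fin.Subset.Properties using (_∈?_; _⊆?_)
open import Data.Fin.Properties using (all?; any?)
open import Data.List using (List; []; _∷_; map; _++_; filter; length; sum)
open import Data.Vec using (Vec; []; _∷_)
open import Data.Product using (Σ; ∃; _×_; _,_)
open import Data.Integer using (ℤ; +_; -_)
open import Relation.Nullary using (Dec; ¬_; _×-dec_; ¬?)
open import Relation.Nullary.Decidable using (_→-dec_)
open import Data.Bool.Properties using (T?)
open import Relation.Binary.PropositionalEquality using (_≡_)
open import Relation.Binary.Construct.Closure.ReflexiveTransitive using (Star)

record Graph (n : ℕ) : Set where
  field
    adj    : Fin n → Fin n → Bool
    sym    : ∀ u v → adj u v ≡ adj v u
    irrefl : ∀ v → adj v v ≡ false

open Graph public

Adj : ∀ {n} → Graph n → Fin n → Fin n → Set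
Adj G u v = T (adj G u v)

Adj? : ∀ {n} (G : Graph n) u v → Dec (Adj G u v)
Adj? G u v = T? (adj G u v)

Connected : ∀ {n} → Graph n → Set
Connected {n} G = ∀ (u v : Fin n) → Star (Adj G) u v

IsIndepDomSetInduced : ∀ {n} → Graph n → Subset n → Subset n → Set
IsIndepDomSetInduced {n} G W U =
  (U ⊆ W)
  × (∀ (u v : Fin n) → u ∈ U → v ∈ U → ¬ Adj G u v)
  × (∀ (v : Fin n) → v ∈ W → v ∉ U → ∃ λ (u : Fin n) → u ∈ U × Adj G u v)

isIndepDomSetInduced? : ∀ {n} (G : Graph n) W U → Dec (IsIndepDomSetInduced G W U)
isIndepDomSetInduced? G W U =
  (U ⊆? W)
  ×-dec all? (λ u → all? (λ v → (u ∈? U) →-dec ((v ∈? U) →-dec ¬? (Adj? G u v))))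
  ×-dec all? (λ v → (v ∈? W) →-dec (¬? (v ∈? U) →-dec any? (λ u → (u ∈? U) ×-dec Adj? G u v)))

allSubsets : ∀ n → List (Subset n)
allSubsets zero    = [] ∷ []
allSubsets (suc n) = map (true ∷_) (allSubsets n) ++ map (false ∷_) (allSubsets n)

indepDomSets : ∀ {n} → Graph n → Subset n → List (Subset n)
indepDomSets {n} G W = filter (isIndepDomSetInduced? G W) (allSubsets n)

-- Coefficient of x^k in ID(G[W], x): number of independent dominating
-- sets of G[W] of cardinality k.  A polynomial is identified with its
-- coefficient function ℕ → ℤ.
ID-coeff : ∀ {n} → Graph n → Subset n → ℕ → ℤ
ID-coeff G W k = + length (filter (λ U → ∣ U ∣ Data.Nat.≟ k) (indepDomSets G W))

neg1^ : ℕ → ℤ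
neg1^ zero    = + 1
neg1^ (suc m) = - neg1^ m

altSumID-coeff : ∀ {n} → Graph n → ℕ → ℤ
altSumID-coeff {n} G k =
  Data.List.foldr Data.Integer._+_ (+ 0)
    (map (λ W → neg1^ ∣ W ∣ Data.Integer.* ID-coeff G W k) (allSubsets n))

one-coeff : ℕ → ℤ
one-coeff zero    = + 1
one-coeff (suc _) = + 0

module Submission where

-- Expand ID(G[W],x) as a sum over candidate sets U and swap
-- the two summations: the coefficient of x^k becomes
--     Σ_{|U| = k} c(U),   where   c(U) = Σ_{W ⊆ V} (-1)^{|W|} [U is an IDS of G[W]].
-- For U = ∅ only W = ∅ qualifies (a nonempty W cannot be dominated by ∅),
-- so c(∅) = 1.  For U ≠ ∅ pick u ∈ U; since G is connected with at least two
-- vertices, u has a neighbour v.  If v ∈ U no W qualifies (U is not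
-- independent); if v ∉ U, toggling v in W keeps U an IDS of G[W] (v is
-- dominated by u) and flips the sign, a sign-reversing involution, so c(U) = 0.
-- Hence only U = ∅ survives and the sum is the constant polynomial 1.

open import Defs hiding (sym)
open import Data.Nat using (ℕ; _≥_; zero; suc; s≤s) renaming (_≟_ to _≟ℕ_)
open import Data.Bool using (true; false; not)
open import Data.Fin using (Fin; _≟_) renaming (zero to fzero; suc to fsuc)
open import Data.Fin.Subset using (Subset; _∈_; _∉_; ∣_∣; ⊥)
open import Data.Fin.Subset.Properties using (_∈?_; ∣⊥∣≡0; ∉⊥)
open import Data.List using (List; []; _∷_; map; _++_; filter; length; foldr)
open import Data.Vec using (_∷_; here; there)
open import Data.Product using (∃; _×_; _,_)
open import Data.Integer using (ℤ; +_; -_; -[1+_]; _+_; _*_)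
open import Data.Integer.Properties
  using (+-comm; +-assoc; +-identityˡ; +-identityʳ; +-commutativeSemigroup;
         *-distribˡ-+; *-zeroʳ; *-identityˡ; *-commutativeSemigroup;
         neg-involutive; neg-distrib-+; neg-distribˡ-*)
open import Algebra.Properties.CommutativeSemigroup +-commutativeSemigroup
  using (interchange)
open import Algebra.Properties.CommutativeSemigroup *-commutativeSemigroup
  using (x∙yz≈z∙xy)
open import Relation.Nullary using (Dec; yes; no; ¬_)
open import Data.Empty using (⊥-elim)
open import Relation.Binary.PropositionalEquality
  using (_≡_; refl; sym; trans; cong; cong₂; subst; module ≡-Reasoning)
open import Relation.Binary.Construct.Closure.ReflexiveTransitive using (Star; ε; _◅_)
open import Function using (_∘_)

open ≡-Reasoning

-- Σ f xs = Σ_{x ∈ xs} f x; this is exactly the shape of altSumID-coeff.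
Σ : {A : Set} → (A → ℤ) → List A → ℤ
Σ f xs = foldr _+_ (+ 0) (map f xs)

Σ-cong : {A : Set} {f g : A → ℤ} → (∀ x → f x ≡ g x) → ∀ xs → Σ f xs ≡ Σ g xs
Σ-cong f≗g []       = refl
Σ-cong f≗g (x ∷ xs) = cong₂ _+_ (f≗g x) (Σ-cong f≗g xs)

Σ-zero : {A : Set} {f : A → ℤ} → (∀ x → f x ≡ + 0) → ∀ xs → Σ f xs ≡ + 0
Σ-zero f≗0 []       = refl
Σ-zero f≗0 (x ∷ xs) = cong₂ _+_ (f≗0 x) (Σ-zero f≗0 xs)

Σ-map : {A B : Set} (f : B → ℤ) (g : A → B) → ∀ xs → Σ f (map g xs) ≡ Σ (f ∘ g) xs
Σ-map f g []       = refl
Σ-map f g (x ∷ xs) = cong (_+_ (f (g x))) (Σ-map f g xs)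

Σ-++ : {A : Set} (f : A → ℤ) → ∀ xs ys → Σ f (xs ++ ys) ≡ Σ f xs + Σ f ys
Σ-++ f []       ys = sym (+-identityˡ _)
Σ-++ f (x ∷ xs) ys = trans (cong (_+_ (f x)) (Σ-++ f xs ys)) (sym (+-assoc (f x) _ _))

Σ-+ : {A : Set} (f g : A → ℤ) → ∀ xs → Σ (λ x → f x + g x) xs ≡ Σ f xs + Σ g xs
Σ-+ f g []       = refl
Σ-+ f g (x ∷ xs) =
  trans (cong (_+_ (f x + g x)) (Σ-+ f g xs)) (interchange (f x) (g x) (Σ f xs) (Σ g xs))

Σ-scale : {A : Set} (c : ℤ) (f : A → ℤ) → ∀ xs → c * Σ f xs ≡ Σ (λ x → c * f x) xs
Σ-scale c f []       = *-zeroʳ c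
Σ-scale c f (x ∷ xs) = trans (*-distribˡ-+ c (f x) (Σ f xs)) (cong (_+_ (c * f x)) (Σ-scale c f xs))

Σ-neg : {A : Set} (f : A → ℤ) → ∀ xs → Σ (λ x → - f x) xs ≡ - Σ f xs
Σ-neg f []       = refl
Σ-neg f (x ∷ xs) = trans (cong (_+_ (- f x)) (Σ-neg f xs)) (sym (neg-distrib-+ (f x) (Σ f xs)))

Σ-swap : {A B : Set} (g : A → B → ℤ) → ∀ xs ys →
  Σ (λ x → Σ (g x) ys) xs ≡ Σ (λ y → Σ (λ x → g x y) xs) ys
Σ-swap g []       ys = sym (Σ-zero (λ _ → refl) ys)
Σ-swap g (x ∷ xs) ys = trans (cong (_+_ (Σ (g x) ys)) (Σ-swap g xs ys))
                             (sym (Σ-+ (g x) (λ y → Σ (λ x → g x y) xs) ys))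

self-negating⇒zero : ∀ i → i ≡ - i → i ≡ + 0
self-negating⇒zero (+ zero)  _  = refl
self-negating⇒zero (+ suc _) ()
self-negating⇒zero -[1+ _ ]  ()

𝟙 : {P : Set} → Dec P → ℤ
𝟙 (yes _) = + 1
𝟙 (no _)  = + 0

𝟙-no : {P : Set} → ¬ P → (p : Dec P) → 𝟙 p ≡ + 0
𝟙-no ¬P (yes p) = ⊥-elim (¬P p)
𝟙-no ¬P (no _)  = refl

𝟙-yes : {P : Set} → P → (p : Dec P) → 𝟙 p ≡ + 1
𝟙-yes P (yes _) = refl
𝟙-yes P (no ¬P) = ⊥-elim (¬P P)

𝟙-⇔ : {P Q : Set} → (P → Q) → (Q → P) → (p : Dec P) (q : Dec Q) → 𝟙 p ≡ 𝟙 q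
𝟙-⇔ _   _   (yes _) (yes _) = refl
𝟙-⇔ P→Q _   (yes p) (no ¬q) = ⊥-elim (¬q (P→Q p))
𝟙-⇔ _   Q→P (no ¬p) (yes q) = ⊥-elim (¬p (Q→P q))
𝟙-⇔ _   _   (no _)  (no _)  = refl

Σ-filter : {A : Set} {P : A → Set} (P? : ∀ x → Dec (P x)) (f : A → ℤ) → ∀ xs →
  Σ f (filter P? xs) ≡ Σ (λ x → 𝟙 (P? x) * f x) xs
Σ-filter P? f [] = refl
Σ-filter P? f (x ∷ xs) with P? x
... | yes _ = cong₂ _+_ (sym (*-identityˡ (f x))) (Σ-filter P? f xs)
... | no _  = trans (Σ-filter P? f xs) (sym (+-identityˡ _))

length-filter : {A : Set} {P : A → Set} (P? : ∀ x → Dec (P x)) → ∀ xs →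
  + length (filter P? xs) ≡ Σ (λ x → 𝟙 (P? x)) xs
length-filter P? [] = refl
length-filter P? (x ∷ xs) with P? x
... | yes _ = cong (_+_ (+ 1)) (length-filter P? xs)
... | no _  = trans (length-filter P? xs) (sym (+-identityˡ _))

Σ-allSubsets-suc : ∀ n (f : Subset (suc n) → ℤ) →
  Σ f (allSubsets (suc n)) ≡ Σ (f ∘ (true ∷_)) (allSubsets n) + Σ (f ∘ (false ∷_)) (allSubsets n)
Σ-allSubsets-suc n f = begin
  Σ f (map (true ∷_) A ++ map (false ∷_) A)        ≡⟨ Σ-++ f (map (true ∷_) A) (map (false ∷_) A) ⟩
  Σ f (map (true ∷_) A) + Σ f (map (false ∷_) A)   ≡⟨ cong₂ _+_ (Σ-map f (true ∷_) A) (Σ-map f (false ∷_) A) ⟩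
  Σ (f ∘ (true ∷_)) A + Σ (f ∘ (false ∷_)) A       ∎
  where A = allSubsets n

Σ-supportedAt⊥ : ∀ n (f : Subset n → ℤ) → (∀ W x → x ∈ W → f W ≡ + 0) →
  Σ f (allSubsets n) ≡ f ⊥
Σ-supportedAt⊥ zero    f f-vanishes = +-identityʳ (f ⊥)
Σ-supportedAt⊥ (suc n) f f-vanishes = begin
  Σ f (allSubsets (suc n))                               ≡⟨ Σ-allSubsets-suc n f ⟩
  Σ (f ∘ (true ∷_)) A + Σ (f ∘ (false ∷_)) A             ≡⟨ cong₂ _+_ withHead withoutHead ⟩
  + 0 + f ⊥                                              ≡⟨ +-identityˡ (f ⊥) ⟩
  f ⊥                                                    ∎
  where
  A = allSubsets n
  withHead : Σ (f ∘ (true ∷_)) A ≡ + 0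
  withHead = Σ-zero (λ W → f-vanishes (true ∷ W) fzero here) A
  withoutHead : Σ (f ∘ (false ∷_)) A ≡ f ⊥
  withoutHead = Σ-supportedAt⊥ n (f ∘ (false ∷_)) (λ W x x∈W → f-vanishes (false ∷ W) (fsuc x) (there x∈W))

toggle : ∀ {n} → Fin n → Subset n → Subset n
toggle fzero    (b ∷ W) = not b ∷ W
toggle (fsuc v) (b ∷ W) = b ∷ toggle v W

toggle-involutive : ∀ {n} (v : Fin n) W → toggle v (toggle v W) ≡ W
toggle-involutive fzero    (true ∷ W)  = refl
toggle-involutive fzero    (false ∷ W) = refl
toggle-involutive (fsuc v) (b ∷ W)     = cong (b ∷_) (toggle-involutive v W)

toggle-keeps : ∀ {n} (v x : Fin n) W → ¬ x ≡ v → x ∈ W → x ∈ toggle v W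
toggle-keeps fzero    fzero    _       x≢v _           = ⊥-elim (x≢v refl)
toggle-keeps fzero    (fsuc x) (b ∷ W) _   (there x∈W) = there x∈W
toggle-keeps (fsuc v) fzero    (b ∷ W) _   here        = here
toggle-keeps (fsuc v) (fsuc x) (b ∷ W) x≢v (there x∈W) =
  there (toggle-keeps v x W (λ x≡v → x≢v (cong fsuc x≡v)) x∈W)

toggle-keeps⁻ : ∀ {n} (v x : Fin n) W → ¬ x ≡ v → x ∈ toggle v W → x ∈ W
toggle-keeps⁻ v x W x≢v x∈ = subst (x ∈_) (toggle-involutive v W) (toggle-keeps v x (toggle v W) x≢v x∈)

sign-toggle : ∀ {n} (v : Fin n) W → neg1^ ∣ toggle v W ∣ ≡ - neg1^ ∣ W ∣
sign-toggle fzero    (true ∷ W)  = sym (neg-involutive _)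
sign-toggle fzero    (false ∷ W) = refl
sign-toggle (fsuc v) (true ∷ W)  = cong -_ (sign-toggle v W)
sign-toggle (fsuc v) (false ∷ W) = sign-toggle v W

Σ-toggle : ∀ n (v : Fin n) (f : Subset n → ℤ) →
  Σ f (allSubsets n) ≡ Σ (f ∘ toggle v) (allSubsets n)
Σ-toggle (suc n) fzero f = begin
  Σ f (allSubsets (suc n))                       ≡⟨ Σ-allSubsets-suc n f ⟩
  Σ (f ∘ (true ∷_)) A + Σ (f ∘ (false ∷_)) A     ≡⟨ +-comm (Σ (f ∘ (true ∷_)) A) _ ⟩
  Σ (f ∘ (false ∷_)) A + Σ (f ∘ (true ∷_)) A     ≡⟨ Σ-allSubsets-suc n (f ∘ toggle fzero) ⟨
  Σ (f ∘ toggle fzero) (allSubsets (suc n))      ∎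
  where A = allSubsets n
Σ-toggle (suc n) (fsuc v) f = begin
  Σ f (allSubsets (suc n))                       ≡⟨ Σ-allSubsets-suc n f ⟩
  Σ (f ∘ (true ∷_)) A + Σ (f ∘ (false ∷_)) A     ≡⟨ cong₂ _+_ (Σ-toggle n v (f ∘ (true ∷_))) (Σ-toggle n v (f ∘ (false ∷_))) ⟩
  Σ (f ∘ (true ∷_) ∘ toggle v) A + Σ (f ∘ (false ∷_) ∘ toggle v) A
                                                 ≡⟨ Σ-allSubsets-suc n (f ∘ toggle (fsuc v)) ⟨
  Σ (f ∘ toggle (fsuc v)) (allSubsets (suc n))   ∎
  where A = allSubsets n

Σ-signReversing : ∀ n (v : Fin n) (f : Subset n → ℤ) →
  (∀ W → f (toggle v W) ≡ - f W) → Σ f (allSubsets n) ≡ + 0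
Σ-signReversing n v f reverses = self-negating⇒zero (Σ f A) (begin
  Σ f A               ≡⟨ Σ-toggle n v f ⟩
  Σ (f ∘ toggle v) A  ≡⟨ Σ-cong reverses A ⟩
  Σ (-_ ∘ f) A        ≡⟨ Σ-neg f A ⟩
  - Σ f A             ∎)
  where A = allSubsets n

module _ {n : ℕ} (G : Graph n) where

  IDS? : ∀ W U → Dec (IsIndepDomSetInduced G W U)
  IDS? = isIndepDomSetInduced? G

  contribution : Subset n → ℤ
  contribution U = Σ (λ W → neg1^ ∣ W ∣ * 𝟙 (IDS? W U)) (allSubsets n)

  ∅-dominates-only-∅ : ∀ W x → x ∈ W → ¬ IsIndepDomSetInduced G W ⊥
  ∅-dominates-only-∅ W x x∈W (_ , _ , dominated) with dominated x x∈W ∉⊥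
  ... | (u , u∈⊥ , _) = ∉⊥ u∈⊥

  ∅-is-IDS-of-∅ : IsIndepDomSetInduced G ⊥ ⊥
  ∅-is-IDS-of-∅ = (λ u∈⊥ → u∈⊥) , (λ u _ u∈⊥ _ _ → ∉⊥ u∈⊥) , (λ _ v∈⊥ _ → ⊥-elim (∉⊥ v∈⊥))

  contribution-∅ : contribution ⊥ ≡ + 1
  contribution-∅ = begin
    contribution ⊥                       ≡⟨ Σ-supportedAt⊥ n _ vanishes ⟩
    neg1^ ∣ ⊥ {n} ∣ * 𝟙 (IDS? ⊥ ⊥)       ≡⟨ cong₂ (λ m i → neg1^ m * i) (∣⊥∣≡0 n) (𝟙-yes ∅-is-IDS-of-∅ (IDS? ⊥ ⊥)) ⟩
    + 1                                  ∎
    where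
    vanishes : ∀ W x → x ∈ W → neg1^ ∣ W ∣ * 𝟙 (IDS? W ⊥) ≡ + 0
    vanishes W x x∈W =
      trans (cong (neg1^ ∣ W ∣ *_) (𝟙-no (∅-dominates-only-∅ W x x∈W) (IDS? W ⊥))) (*-zeroʳ (neg1^ ∣ W ∣))

  -- If v ∉ U has a neighbour in U, then U is an IDS of G[W] iff of G[W △ {v}]:
  -- v never needs to be in U, and when present it is dominated.
  IDS-toggle : ∀ U u v W → u ∈ U → Adj G u v → v ∉ U →
    IsIndepDomSetInduced G W U → IsIndepDomSetInduced G (toggle v W) U
  IDS-toggle U u v W u∈U uv v∉U (U⊆W , independent , dominated) =
    (λ {x} x∈U → toggle-keeps v x W (λ x≡v → v∉U (subst (_∈ U) x≡v x∈U)) (U⊆W x∈U)) ,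
    independent , dominated′
    where
    dominated′ : ∀ x → x ∈ toggle v W → x ∉ U → ∃ λ y → y ∈ U × Adj G y x
    dominated′ x x∈ x∉U with x ≟ v
    ... | yes refl = u , u∈U , uv
    ... | no x≢v   = dominated x (toggle-keeps⁻ v x W x≢v x∈) x∉U

  contribution-vanishes : ∀ U u v → u ∈ U → Adj G u v → contribution U ≡ + 0
  contribution-vanishes U u v u∈U uv with v ∈? U
  ... | yes v∈U = Σ-zero notIndependent (allSubsets n)
    where
    notIndependent : ∀ W → neg1^ ∣ W ∣ * 𝟙 (IDS? W U) ≡ + 0
    notIndependent W = trans (cong (neg1^ ∣ W ∣ *_)
      (𝟙-no (λ (_ , independent , _) → independent u v u∈U v∈U uv) (IDS? W U))) (*-zeroʳ (neg1^ ∣ W ∣))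
  ... | no v∉U = Σ-signReversing n v _ reverses
    where
    reverses : ∀ W → neg1^ ∣ toggle v W ∣ * 𝟙 (IDS? (toggle v W) U) ≡ - (neg1^ ∣ W ∣ * 𝟙 (IDS? W U))
    reverses W = begin
      neg1^ ∣ toggle v W ∣ * 𝟙 (IDS? (toggle v W) U)   ≡⟨ cong₂ _*_ (sign-toggle v W) sameIndicator ⟩
      - neg1^ ∣ W ∣ * 𝟙 (IDS? W U)                     ≡⟨ neg-distribˡ-* (neg1^ ∣ W ∣) _ ⟨
      - (neg1^ ∣ W ∣ * 𝟙 (IDS? W U))                   ∎
      where
      back : IsIndepDomSetInduced G (toggle v W) U → IsIndepDomSetInduced G W U
      back p = subst (λ Z → IsIndepDomSetInduced G Z U) (toggle-involutive v W)
                     (IDS-toggle U u v (toggle v W) u∈U uv v∉U p)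
      sameIndicator : 𝟙 (IDS? (toggle v W) U) ≡ 𝟙 (IDS? W U)
      sameIndicator = 𝟙-⇔ back (IDS-toggle U u v W u∈U uv v∉U) (IDS? (toggle v W) U) (IDS? W U)

  altSumID-coeff-by-contributions : ∀ k →
    altSumID-coeff G k ≡ Σ (λ U → 𝟙 (∣ U ∣ ≟ℕ k) * contribution U) (allSubsets n)
  altSumID-coeff-by-contributions k = begin
    Σ (λ W → sgn W * ID-coeff G W k) A                        ≡⟨ Σ-cong expand A ⟩
    Σ (λ W → Σ (λ U → sgn W * (𝟙 (IDS? W U) * size U)) A) A   ≡⟨ Σ-swap _ A A ⟩
    Σ (λ U → Σ (λ W → sgn W * (𝟙 (IDS? W U) * size U)) A) A   ≡⟨ Σ-cong collect A ⟩
    Σ (λ U → size U * contribution U) A                       ∎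
    where
    A = allSubsets n
    sgn : Subset n → ℤ
    sgn W = neg1^ ∣ W ∣
    size : Subset n → ℤ
    size U = 𝟙 (∣ U ∣ ≟ℕ k)
    expand : ∀ W → sgn W * ID-coeff G W k ≡ Σ (λ U → sgn W * (𝟙 (IDS? W U) * size U)) A
    expand W = begin
      sgn W * ID-coeff G W k                                ≡⟨ cong (sgn W *_) (length-filter _ (filter (IDS? W) A)) ⟩
      sgn W * Σ size (filter (IDS? W) A)                    ≡⟨ cong (sgn W *_) (Σ-filter (IDS? W) size A) ⟩
      sgn W * Σ (λ U → 𝟙 (IDS? W U) * size U) A             ≡⟨ Σ-scale (sgn W) _ A ⟩
      Σ (λ U → sgn W * (𝟙 (IDS? W U) * size U)) A           ∎
    collect : ∀ U → Σ (λ W → sgn W * (𝟙 (IDS? W U) * size U)) A ≡ size U * contribution U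
    collect U = begin
      Σ (λ W → sgn W * (𝟙 (IDS? W U) * size U)) A           ≡⟨ Σ-cong (λ W → x∙yz≈z∙xy (sgn W) _ (size U)) A ⟩
      Σ (λ W → size U * (sgn W * 𝟙 (IDS? W U))) A           ≡⟨ Σ-scale (size U) _ A ⟨
      size U * contribution U                               ∎

-- In a connected graph with at least two vertices every vertex has a neighbour:
-- a walk to a different vertex starts with an edge.
hasNeighbour : ∀ n (G : Graph n) → n ≥ 2 → Connected G → ∀ u → ∃ λ v → Adj G u v
hasNeighbour (suc zero)    _ (s≤s ()) _ _
hasNeighbour (suc (suc m)) G _ connected u = firstStep (connected u (other u)) (other≢ u)
  where
  other : Fin (suc (suc m)) → Fin (suc (suc m))
  other fzero    = fsuc fzero
  other (fsuc _) = fzero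
  other≢ : ∀ u → ¬ u ≡ other u
  other≢ fzero    ()
  other≢ (fsuc _) ()
  firstStep : ∀ {x y} → Star (Adj G) x y → ¬ x ≡ y → ∃ λ v → Adj G x v
  firstStep ε                   x≢x = ⊥-elim (x≢x refl)
  firstStep (_◅_ {j = v} xv _) _   = v , xv

mainTheorem6 : ∀ (n : ℕ) (G : Graph n) → n ≥ 2 → Connected G →
    ∀ (k : ℕ) → altSumID-coeff G k ≡ one-coeff k
mainTheorem6 n G n≥2 connected k = begin
  altSumID-coeff G k                                       ≡⟨ altSumID-coeff-by-contributions G k ⟩
  Σ term (allSubsets n)                                    ≡⟨ Σ-supportedAt⊥ n term nonemptyVanishes ⟩
  𝟙 (∣ ⊥ {n} ∣ ≟ℕ k) * contribution G ⊥            ≡⟨ cong₂ (λ m c → 𝟙 (m ≟ℕ k) * c) (∣⊥∣≡0 n) (contribution-∅ G) ⟩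
  𝟙 (0 ≟ℕ k) * + 1                                 ≡⟨ constantOne k ⟩
  one-coeff k                                              ∎
  where
  term : Subset n → ℤ
  term U = 𝟙 (∣ U ∣ ≟ℕ k) * contribution G U
  nonemptyVanishes : ∀ U u → u ∈ U → term U ≡ + 0
  nonemptyVanishes U u u∈U with hasNeighbour n G n≥2 connected u
  ... | v , uv = trans (cong (𝟙 (∣ U ∣ ≟ℕ k) *_) (contribution-vanishes G U u v u∈U uv)) (*-zeroʳ (𝟙 (∣ U ∣ ≟ℕ k)))
  constantOne : ∀ k → 𝟙 (0 ≟ℕ k) * + 1 ≡ one-coeff k
  constantOne zero    = refl
  constantOne (suc _) = refl
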